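{- Let $(X,S)$ be an association scheme and let $F$ be a field. Then for every $A\in FS$ and every $\lambda\in F$, the relation $e_\lambda(A)=\{(x,y)\in X\times X:\ \lambda Ax=Ay\}$ belongs to $S^*$.
   Context: An association scheme $(X,S)$ consists of a finite set $X$ and a partition $S$ of $X\times X$ closed under transposition, containing the diagonal $\Delta$, such that for $r,s,t\in S$ the number $|\{z:(x,z)\in r,(z,y)\in s\}|$ is independent of $(x,y)\in t$. $S^*$ denotes the set of all unions of subsets of $S$ (including the empty union). For a field $F$, the adjacency algebra $FS\subseteq\mathrm{Mat}_X(F)$ is the $F$-span of the $\{0,1\}$ adjacency matrices $A_s$, $s\in S$. For $A\in \mathrm{Mat}_X(F)$ and $x\in X$, $Ax$ denotes the $x$-th column of $A$, viewed as a vector in $F^X$. -}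

module Defs where

open import Level using (Level; _⊔_; suc)
open import Algebra.Bundles using (CommutativeRing)
open import Data.Nat using (ℕ; zero) renaming (suc to sucℕ)
open import Data.Fin using (Fin; _≟_)
open import Data.Product using (Σ; ∃; _×_; _,_)
open import Data.Bool using (Bool; true; false; if_then_else_)
open import Relation.Nullary using (¬_; Dec; yes; no; does)
open import Relation.Binary.PropositionalEquality using (_≡_)
open import Function.Bundles using (_⇔_)

record Field (c ℓ : Level) : Set (suc (c ⊔ ℓ)) where
  field
    commutativeRing : CommutativeRing c ℓ
  open CommutativeRing commutativeRing public
  field
    1≉0     : ¬ (1# ≈ 0#)
    inverse : ∀ x → ¬ (x ≈ 0#) → Σ Carrier (λ y → x * y ≈ 1#)

count : ∀ {n} → (Fin n → Bool) → ℕ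
count {zero}   p = 0
count {sucℕ n} p = (if p Fin.zero then 1 else 0) Data.Nat.+ count (λ i → p (Fin.suc i))
  where import Data.Nat

-- The partition S of X × X is given by its classes indexed by Fin d:
-- rel x y is the (unique) class containing (x , y).  Every class is
-- required to be nonempty, so that S is a genuine partition.

record AssociationScheme (n : ℕ) : Set where
  field
    d         : ℕ
    rel       : Fin n → Fin n → Fin d
    nonempty  : ∀ (s : Fin d) → Σ (Fin n) (λ x → Σ (Fin n) (λ y → rel x y ≡ s))
    diag      : Fin d
    diag-spec : ∀ x y → (rel x y ≡ diag) ⇔ (x ≡ y)
    transp      : Fin d → Fin d
    transp-spec : ∀ x y → rel y x ≡ transp (rel x y)
    -- intersection numbers are well defined
    regular : ∀ (r s t : Fin d) (x y x′ y′ : Fin n) →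
              rel x y ≡ t → rel x′ y′ ≡ t →
              count (λ z → does (rel x z ≟ r) Data.Bool.∧ does (rel z y ≟ s))
                ≡ count (λ z → does (rel x′ z ≟ r) Data.Bool.∧ does (rel z y′ ≟ s))

module _ {c ℓ} (F : Field c ℓ) where
  open Field F

  Matrix : ℕ → Set c
  Matrix n = Fin n → Fin n → Carrier   -- A i j = entry in row i, column j

  sumF : ∀ {d} → (Fin d → Carrier) → Carrier
  sumF {zero}   f = 0#
  sumF {sucℕ d} f = f Fin.zero + sumF (λ i → f (Fin.suc i))

  module _ {n} (𝒮 : AssociationScheme n) where
    open AssociationScheme 𝒮

    adj : Fin d → Matrix n
    adj s x y = if does (rel x y ≟ s) then 1# else 0#

    InAdjacencyAlgebra : Matrix n → Set (c ⊔ ℓ)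
    InAdjacencyAlgebra A =
      Σ (Fin d → Carrier) λ coeff → ∀ x y → A x y ≈ sumF (λ s → coeff s * adj s x y)

    -- a relation R ⊆ X × X belongs to S* : it is the union of the classes
    -- in some subset T ⊆ S
    InUnionClosure : ∀ {p} → (Fin n → Fin n → Set p) → Set (suc (c ⊔ ℓ) ⊔ p)
    InUnionClosure {p} R =
      Σ (Fin d → Set (c ⊔ ℓ)) λ T → ∀ x y → R x y ⇔ T (rel x y)

  ScaledColumnsEqual : ∀ {n} → Matrix n → Carrier → Fin n → Fin n → Set ℓ
  ScaledColumnsEqual A λ′ x y = ∀ z → λ′ * A z x ≈ A z y

  eigenRel : ∀ {n} → Matrix n → Carrier → Fin n → Fin n → Set ℓ
  eigenRel = ScaledColumnsEqual

module Submission where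

-- (1) Path lifting: if rel x y = rel x′ y′, then for every z′ there is a z
--     with rel x z = rel x′ z′ and rel z y = rel z′ y′.  With
--     r = rel x′ z′ and s = rel z′ y′, the point z′ shows that the
--     intersection number p^t_{rs}, t = rel x y, counted at (x′ , y′), is
--     positive; regularity gives the same count at (x , y).  The counting
--     lemmas at the start turn "positive count" into a witness and back.
-- (2) A relation on X that is constant on the classes of S lies in S*:
--     take T to be the set of classes on which it holds at a representative.
--
-- Then over the field F:
-- (3) Every A ∈ FS is a class function: A z x depends only on rel z x.
-- (4) For a class function A, e_λ(A) is constant on the classes of S:
--     comparing column x′ at row z′ with column x at the lifted row z of (1).
--
-- The theorem is (2) applied to e_λ(A), using (3) and (4).

open import Defs
open import Level using (Lift; lift; lower; _⊔_)
open import Data.Empty using (⊥-elim)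
open import Data.Nat using (ℕ; zero; suc; _<_; z<s)
open import Data.Fin using (Fin; _≟_)
import Data.Fin as Fin
open import Data.Product using (Σ; ∃; _×_; _,_; proj₁; proj₂)
open import Data.Bool using (Bool; true; false; T; _∧_; if_then_else_)
open import Relation.Nullary using (Dec; yes; no; does)
open import Data.Bool.Properties using (T-∧)
open import Relation.Binary.PropositionalEquality
  using (_≡_; refl; sym; trans; cong; subst)
open import Function.Bundles using (_⇔_; mk⇔; Equivalence)

count-positive : ∀ {n} (p : Fin n → Bool) (z : Fin n) → T (p z) → 0 < count p
count-positive p Fin.zero pz with p Fin.zero
... | true  = z<s
... | false = ⊥-elim pz
count-positive {suc n} p (Fin.suc z) pz with p Fin.zero
... | true  = z<s
... | false = count-positive (λ i → p (Fin.suc i)) z pz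

count-witness : ∀ {n} (p : Fin n → Bool) → 0 < count p → ∃ λ z → T (p z)
count-witness {zero}  p ()
count-witness {suc n} p positive with p Fin.zero in p0
... | true  = Fin.zero , subst T (sym p0) _
... | false with count-witness (λ i → p (Fin.suc i)) positive
...   | z , pz = Fin.suc z , pz

does-sound : ∀ {a} {A : Set a} (a? : Dec A) → T (does a?) ⇔ A
does-sound (yes a) = mk⇔ (λ _ → a) (λ _ → _)
does-sound (no ¬a) = mk⇔ (λ ()) ¬a

module _ {n : ℕ} (𝒮 : AssociationScheme n) where
  open AssociationScheme 𝒮

  -- The Boolean test "rel x z = r and rel z y = s" whose count is the
  -- intersection number p^{rel x y}_{rs}.
  path : (r s : Fin d) (x y : Fin n) → Fin n → Bool
  path r s x y z = does (rel x z ≟ r) ∧ does (rel z y ≟ s)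

  transpose-class : ∀ x z x′ z′ → rel x z ≡ rel x′ z′ → rel z x ≡ rel z′ x′
  transpose-class x z x′ z′ same-class =
    trans (transp-spec x z) (trans (cong transp same-class) (sym (transp-spec x′ z′)))

  lift-path : ∀ x y x′ y′ → rel x y ≡ rel x′ y′ → ∀ z′ →
              ∃ λ z → rel x z ≡ rel x′ z′ × rel z y ≡ rel z′ y′
  lift-path x y x′ y′ same-class z′ =
    z , Equivalence.to (does-sound (rel x z ≟ r)) (proj₁ onPath)
      , Equivalence.to (does-sound (rel z y ≟ s)) (proj₂ onPath)
    where
    r s : Fin d
    r = rel x′ z′
    s = rel z′ y′
    z′-on-path : T (path r s x′ y′ z′)
    z′-on-path = Equivalence.from T-∧
      (Equivalence.from (does-sound (rel x′ z′ ≟ r)) refl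
      , Equivalence.from (does-sound (rel z′ y′ ≟ s)) refl)
    positive : 0 < count (path r s x y)
    positive = subst (0 <_) (regular r s (rel x y) x′ y′ x y (sym same-class) refl)
                     (count-positive (path r s x′ y′) z′ z′-on-path)
    witness : ∃ λ z → T (path r s x y z)
    witness = count-witness (path r s x y) positive
    z : Fin n
    z = proj₁ witness
    onPath : T (does (rel x z ≟ r)) × T (does (rel z y ≟ s))
    onPath = Equivalence.to T-∧ (proj₂ witness)

  class-invariant⇒union-closure :
    ∀ {c ℓ} (F : Field c ℓ) (R : Fin n → Fin n → Set ℓ) →
    (∀ x y x′ y′ → rel x y ≡ rel x′ y′ → R x y → R x′ y′) →
    InUnionClosure F 𝒮 R
  class-invariant⇒union-closure {c} {ℓ} F R invariant =
    Holds , λ x y → mk⇔ (λ Rxy → lift (invariant x y _ _ (sym (rep-spec (rel x y))) Rxy))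
                        (λ held → invariant _ _ x y (rep-spec (rel x y)) (lower held))
    where
    repˡ repʳ : Fin d → Fin n
    repˡ t = proj₁ (nonempty t)
    repʳ t = proj₁ (proj₂ (nonempty t))
    rep-spec : ∀ t → rel (repˡ t) (repʳ t) ≡ t
    rep-spec t = proj₂ (proj₂ (nonempty t))
    Holds : Fin d → Set (c ⊔ ℓ)
    Holds t = Lift c (R (repˡ t) (repʳ t))

  module _ {c ℓ} (F : Field c ℓ) where
    open Field F using (Carrier; setoid; _*_; *-congˡ; 1#; 0#)
    open Field F using () renaming (sym to ≈-sym)
    open import Relation.Binary.Reasoning.Setoid setoid

    ClassFunction : Matrix F n → Set (c ⊔ ℓ)
    ClassFunction A = Σ (Fin d → Carrier) λ g → ∀ z x → Field._≈_ F (A z x) (g (rel z x))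

    adjacency⇒class-function : ∀ A → InAdjacencyAlgebra F 𝒮 A → ClassFunction A
    adjacency⇒class-function A (coeff , expansion) =
      (λ t → sumF F (λ s → coeff s * (if does (t ≟ s) then 1# else 0#))) , expansion

    eigenRel-class-invariant :
      ∀ A → ClassFunction A → ∀ λ′ x y x′ y′ → rel x y ≡ rel x′ y′ →
      eigenRel F A λ′ x y → eigenRel F A λ′ x′ y′
    eigenRel-class-invariant A (g , A≈g) λ′ x y x′ y′ same-class eigen z′ =
      begin
        λ′ * A z′ x′          ≈⟨ *-congˡ (A≈g z′ x′) ⟩
        λ′ * g (rel z′ x′)    ≡⟨ cong (λ t → λ′ * g t) (sym (transpose-class x z x′ z′ xz≡x′z′)) ⟩
        λ′ * g (rel z x)      ≈⟨ *-congˡ (≈-sym (A≈g z x)) ⟩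
        λ′ * A z x            ≈⟨ eigen z ⟩
        A z y                 ≈⟨ A≈g z y ⟩
        g (rel z y)           ≡⟨ cong g zy≡z′y′ ⟩
        g (rel z′ y′)         ≈⟨ ≈-sym (A≈g z′ y′) ⟩
        A z′ y′               ∎
      where
      lifted : ∃ λ z → rel x z ≡ rel x′ z′ × rel z y ≡ rel z′ y′
      lifted = lift-path x y x′ y′ same-class z′
      z : Fin n
      z = proj₁ lifted
      xz≡x′z′ : rel x z ≡ rel x′ z′
      xz≡x′z′ = proj₁ (proj₂ lifted)
      zy≡z′y′ : rel z y ≡ rel z′ y′
      zy≡z′y′ = proj₂ (proj₂ lifted)

theorem2p1 : ∀ {c ℓ} (F : Field c ℓ) {n : ℕ} (𝒮 : AssociationScheme n)
             (A : Matrix F n) → InAdjacencyAlgebra F 𝒮 A →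
             (λ′ : Field.Carrier F) →
             InUnionClosure F 𝒮 (eigenRel F A λ′)
theorem2p1 F 𝒮 A A∈FS λ′ =
  class-invariant⇒union-closure 𝒮 F (eigenRel F A λ′)
    (eigenRel-class-invariant 𝒮 F A (adjacency⇒class-function 𝒮 F A A∈FS) λ′)
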